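{- Let $m$ be a positive integer and let $P$ be an $n$-vertex path with vertices $v_1,\dots,v_n$ in this order. Let $L$ be a list assignment on $P$ with $|L(v_1)|=|L(v_n)|\ge 2m$ and $|L(v_i)|=4m$ for $i\in\{2,\dots,n-1\}$. Define $X_1=L(v_1)$ and $X_i=L(v_i)\setminus X_{i-1}$ for $i>1$, and $S_L(P)=\sum_{i=1}^n |X_i|$. Then $P$ has a $2m$-tuple $L$-colouring if and only if $S_L(P)\ge 2mn$.
   Context: A $b$-tuple $L$-colouring of a graph assigns to each vertex $v$ a $b$-element subset of $L(v)$ such that adjacent vertices receive disjoint sets. -}

module Defs where

open import Data.Nat using (ℕ; zero; suc; _+_; _*_; _≤_)
open import Data.Fin using (Fin; zero; suc; inject₁; fromℕ; toℕ)
open import Data.Fin.Subset using (Subset; ⊥; _─_; _∩_; _⊆_; ∣_∣; Empty)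
open import Data.Vec using (Vec; []; _∷_; lookup)
open import Data.Product using (Σ; _×_)
open import Relation.Binary.PropositionalEquality using (_≡_)

-- A path with vertices v₁,…,v_N (N = suc n) is indexed by
-- Fin (suc n): vertex i is adjacent to vertex i+1.  A list assignment is a
-- vector of lists, one for each vertex.

-- sizes |X_i| where X_1 = L(v_1), X_i = L(v_i) ∖ X_{i-1}; `prev` is X_{i-1}
-- (⊥ for the first vertex, so X_1 = L(v_1) ∖ ∅ = L(v_1)).
Xsum : ∀ {k n} → Subset k → Vec (Subset k) n → ℕ
Xsum prev [] = 0
Xsum prev (A ∷ As) = ∣ A ─ prev ∣ + Xsum (A ─ prev) As

S : ∀ {k n} → Vec (Subset k) n → ℕ
S L = Xsum ⊥ L

TupleColouring : ∀ {k n} → ℕ → Vec (Subset k) (suc n) → Set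
TupleColouring {k} {n} b L =
  Σ (Fin (suc n) → Subset k) λ c →
    (∀ i → c i ⊆ lookup L i) ×
    (∀ i → ∣ c i ∣ ≡ b) ×
    (∀ (i : Fin n) → Empty (c (inject₁ i) ∩ c (suc i)))

-- Write b = 2m, X₁,…,X_n for the sets of the statement and X₀ = ∅.  If c is a b-tuple
-- colouring, then c_i ∖ X_{i-1} ⊆ X_i is disjoint from c_{i+1} ∩ X_i, so
-- b + |c_{i+1} ∩ X_i| ≤ |c_i ∩ X_{i-1}| + |X_i|, and these inequalities telescope to bn ≤ S_L(P).
-- Conversely, let K₀ = 0 and K_i = K_{i-1} + |X_i| - b.  These budgets are nonnegative because
-- |L(v_i)| ≥ 2b and |X_{i-1}| ≤ b + K_{i-1}, and K_{n-1} + |X_n| ≥ b is exactly S_L(P) ≥ bn.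
-- Colour the path backwards from v_n keeping |c_i ∩ X_{i-1}| ≤ K_{i-1}: as c_{i+1} meets X_i in
-- at most K_i colours, L(v_i) ∖ c_{i+1} has at least b - K_{i-1} colours outside X_{i-1}, and at
-- least b colours in all (|L(v_i)| ≥ 2b, or K_{i-1} = 0 when i = 1), so c_i can be chosen.

module Submission where

open import Defs
open import Data.Nat using (ℕ; zero; suc; _+_; _*_; _∸_; _≤_; z≤n; s≤s)
open import Data.Nat.Properties
open import Algebra.Properties.CommutativeSemigroup +-commutativeSemigroup
  using (x∙yz≈y∙xz; xy∙z≈y∙xz; xy∙z≈xz∙y; xy∙z≈yz∙x)
open import Data.Fin using (Fin; zero; suc; fromℕ; toℕ)
open import Data.Fin.Subset
open import Data.Fin.Subset.Properties
open import Data.Vec using (Vec; []; _∷_; here; there; lookup)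
open import Data.Vec.Functional using () renaming (_∷_ to _◂_)
open import Data.Product as Product using (Σ; _×_; _,_; proj₁; proj₂; ∃-syntax)
open import Data.Sum using (_⊎_; inj₁; inj₂)
open import Function using (_∘_)
open import Function.Bundles using (_⇔_; mk⇔)
open import Relation.Binary.PropositionalEquality
  using (_≡_; _≢_; refl; sym; trans; cong; cong₂; subst; subst₂; module ≡-Reasoning)

private variable
  b k n K K′ : ℕ
  x : Fin k
  p p′ q q′ r A Q : Subset k
  As : Vec (Subset k) n

∣p∣≡∣p∩q∣+∣p─q∣ : ∀ (p q : Subset k) → ∣ p ∣ ≡ ∣ p ∩ q ∣ + ∣ p ─ q ∣
∣p∣≡∣p∩q∣+∣p─q∣ []            []            = refl
∣p∣≡∣p∩q∣+∣p─q∣ (outside ∷ p) (inside  ∷ q) = ∣p∣≡∣p∩q∣+∣p─q∣ p q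
∣p∣≡∣p∩q∣+∣p─q∣ (outside ∷ p) (outside ∷ q) = ∣p∣≡∣p∩q∣+∣p─q∣ p q
∣p∣≡∣p∩q∣+∣p─q∣ (inside  ∷ p) (inside  ∷ q) = cong suc (∣p∣≡∣p∩q∣+∣p─q∣ p q)
∣p∣≡∣p∩q∣+∣p─q∣ (inside  ∷ p) (outside ∷ q) =
  trans (cong suc (∣p∣≡∣p∩q∣+∣p─q∣ p q)) (sym (+-suc _ _))

∣p∣≤∣p─q∣+∣q∣ : ∀ (p q : Subset k) → ∣ p ∣ ≤ ∣ p ─ q ∣ + ∣ q ∣
∣p∣≤∣p─q∣+∣q∣ p q = begin
  ∣ p ∣                 ≡⟨ ∣p∣≡∣p∩q∣+∣p─q∣ p q ⟩
  ∣ p ∩ q ∣ + ∣ p ─ q ∣ ≤⟨ +-monoˡ-≤ _ (∣p∩q∣≤∣q∣ p q) ⟩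
  ∣ q ∣ + ∣ p ─ q ∣     ≡⟨ +-comm ∣ q ∣ _ ⟩
  ∣ p ─ q ∣ + ∣ q ∣     ∎
  where open ≤-Reasoning

x∈p─q⁻ : ∀ (p q : Subset k) → x ∈ p ─ q → x ∈ p × x ∉ q
x∈p─q⁻ (inside ∷ p) (outside ∷ q) here = here , λ ()
x∈p─q⁻ {x = zero} (_ ∷ p) (inside ∷ q) ()
x∈p─q⁻ (_ ∷ p) (_ ∷ q) (there x∈p─q) =
  Product.map there (_∘ drop-there) (x∈p─q⁻ p q x∈p─q)

─-monoˡ-⊆ : ∀ (r : Subset k) → p ⊆ q → p ─ r ⊆ q ─ r
─-monoˡ-⊆ {p = p} r p⊆q x∈p─r =
  let x∈p , x∉r = x∈p─q⁻ p r x∈p─r in x∈p∧x∉q⇒x∈p─q (p⊆q x∈p) x∉r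

p⊆q─r⇒Empty[p∩r] : ∀ (q r : Subset k) → p ⊆ q ─ r → Empty (p ∩ r)
p⊆q─r⇒Empty[p∩r] {p = p} q r p⊆q─r (x , x∈p∩r) =
  let x∈p , x∈r = x∈p∩q⁻ p r x∈p∩r in proj₂ (x∈p─q⁻ q r (p⊆q─r x∈p)) x∈r

Empty-∩-anti : p ⊆ p′ → q ⊆ q′ → Empty (p′ ∩ q′) → Empty (p ∩ q)
Empty-∩-anti {p = p} {q = q} p⊆p′ q⊆q′ empty (x , x∈p∩q) =
  empty (x , x∈p∩q⁺ (Product.map p⊆p′ q⊆q′ (x∈p∩q⁻ p q x∈p∩q)))

Empty[p∩q]⇒∣p∣+∣q∣≤∣r∣ : p ⊆ r → q ⊆ r → Empty (p ∩ q) → ∣ p ∣ + ∣ q ∣ ≤ ∣ r ∣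
Empty[p∩q]⇒∣p∣+∣q∣≤∣r∣ {p = p} {r} {q} p⊆r q⊆r disjoint = begin
  ∣ p ∣ + ∣ q ∣         ≤⟨ +-mono-≤ (p⊆q⇒∣p∣≤∣q∣ p⊆r─q) (p⊆q⇒∣p∣≤∣q∣ q⊆r∩q) ⟩
  ∣ r ─ q ∣ + ∣ r ∩ q ∣ ≡⟨ +-comm ∣ r ─ q ∣ _ ⟩
  ∣ r ∩ q ∣ + ∣ r ─ q ∣ ≡⟨ ∣p∣≡∣p∩q∣+∣p─q∣ r q ⟨
  ∣ r ∣                 ∎
  where
  open ≤-Reasoning
  p⊆r─q : p ⊆ r ─ q
  p⊆r─q x∈p = x∈p∧x∉q⇒x∈p─q (p⊆r x∈p) (λ x∈q → disjoint (_ , x∈p∩q⁺ (x∈p , x∈q)))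
  q⊆r∩q : q ⊆ r ∩ q
  q⊆r∩q x∈q = x∈p∩q⁺ (q⊆r x∈q , x∈q)

∣p∣≤∣p∩r∣+∣q─r∣ : ∀ (r : Subset k) → p ⊆ q → ∣ p ∣ ≤ ∣ p ∩ r ∣ + ∣ q ─ r ∣
∣p∣≤∣p∩r∣+∣q─r∣ {p = p} {q = q} r p⊆q = begin
  ∣ p ∣                 ≡⟨ ∣p∣≡∣p∩q∣+∣p─q∣ p r ⟩
  ∣ p ∩ r ∣ + ∣ p ─ r ∣ ≤⟨ +-monoʳ-≤ _ (p⊆q⇒∣p∣≤∣q∣ (─-monoˡ-⊆ r p⊆q)) ⟩
  ∣ p ∩ r ∣ + ∣ q ─ r ∣ ∎
  where open ≤-Reasoning

choose-⊆ : ∀ (W P : Subset k) b K → b ≤ ∣ W ─ P ∣ + K → b ≤ ∣ W ∣ →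
  ∃[ c ] c ⊆ W × ∣ c ∣ ≡ b × ∣ c ∩ P ∣ ≤ K
choose-⊆ {k} W P zero K _ _ =
  ⊥ , ⊥⊆ , ∣⊥∣≡0 k , subst (_≤ K) (sym (trans (cong ∣_∣ (∩-zeroˡ P)) (∣⊥∣≡0 k))) z≤n
choose-⊆ (outside ∷ W) (inside ∷ P) (suc b) K b≤∣W─P∣+K b≤∣W∣
  with c , c⊆W , ∣c∣≡b , meet ← choose-⊆ W P (suc b) K b≤∣W─P∣+K b≤∣W∣
  = outside ∷ c , out⊆ c⊆W , ∣c∣≡b , meet
choose-⊆ (outside ∷ W) (outside ∷ P) (suc b) K b≤∣W─P∣+K b≤∣W∣
  with c , c⊆W , ∣c∣≡b , meet ← choose-⊆ W P (suc b) K b≤∣W─P∣+K b≤∣W∣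
  = outside ∷ c , out⊆ c⊆W , ∣c∣≡b , meet
choose-⊆ (inside ∷ W) (outside ∷ P) (suc b) K (s≤s b≤∣W─P∣+K) (s≤s b≤∣W∣)
  with c , c⊆W , ∣c∣≡b , meet ← choose-⊆ W P b K b≤∣W─P∣+K b≤∣W∣
  = inside ∷ c , in⊆in c⊆W , cong suc ∣c∣≡b , meet
choose-⊆ (inside ∷ W) (inside ∷ P) (suc b) zero b≤∣W─P∣ _
  with c , c⊆W , ∣c∣≡b , meet ←
    choose-⊆ W P (suc b) zero b≤∣W─P∣ (≤-trans b≤∣W─P∣ (≤-trans (≤-reflexive (+-identityʳ _)) (∣p─q∣≤∣p∣ W P)))
  = outside ∷ c , out⊆ c⊆W , ∣c∣≡b , meet
choose-⊆ (inside ∷ W) (inside ∷ P) (suc b) (suc K) b≤∣W─P∣+K (s≤s b≤∣W∣)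
  with c , c⊆W , ∣c∣≡b , meet ←
    choose-⊆ W P b K (≤-pred (subst (suc b ≤_) (+-suc _ K) b≤∣W─P∣+K)) b≤∣W∣
  = inside ∷ c , in⊆in c⊆W , cong suc ∣c∣≡b , s≤s meet

∣p∣+∣q∩[r─s]∣≤∣p∩s∣+∣r─s∣ : ∀ (s : Subset k) → p ⊆ r → Empty (p ∩ q) →
  ∣ p ∣ + ∣ q ∩ (r ─ s) ∣ ≤ ∣ p ∩ s ∣ + ∣ r ─ s ∣
∣p∣+∣q∩[r─s]∣≤∣p∩s∣+∣r─s∣ {p = p} {r = r} {q = q} s p⊆r disjoint = begin
  ∣ p ∣ + ∣ q ∩ (r ─ s) ∣                   ≡⟨ cong (_+ _) (∣p∣≡∣p∩q∣+∣p─q∣ p s) ⟩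
  ∣ p ∩ s ∣ + ∣ p ─ s ∣ + ∣ q ∩ (r ─ s) ∣   ≡⟨ +-assoc ∣ p ∩ s ∣ _ _ ⟩
  ∣ p ∩ s ∣ + (∣ p ─ s ∣ + ∣ q ∩ (r ─ s) ∣) ≤⟨ +-monoʳ-≤ ∣ p ∩ s ∣ parts-of-r─s ⟩
  ∣ p ∩ s ∣ + ∣ r ─ s ∣                     ∎
  where
  open ≤-Reasoning
  parts-of-r─s : ∣ p ─ s ∣ + ∣ q ∩ (r ─ s) ∣ ≤ ∣ r ─ s ∣
  parts-of-r─s = Empty[p∩q]⇒∣p∣+∣q∣≤∣r∣ (─-monoˡ-⊆ s p⊆r) (p∩q⊆q q (r ─ s))
    (Empty-∩-anti (p─q⊆p p s) (p∩q⊆p q (r ─ s)) disjoint)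

colouring-tail : ∀ {A} {As : Vec (Subset k) (suc n)} →
  TupleColouring b (A ∷ As) → TupleColouring b As
colouring-tail (c , ⊆L , ∣c∣≡b , proper) =
  c ∘ suc , (λ i → ⊆L (suc i)) , (λ i → ∣c∣≡b (suc i)) , (λ i → proper (suc i))

colouring-cons : ∀ {c₀ A} {As : Vec (Subset k) (suc n)} (χ : TupleColouring b As) →
  c₀ ⊆ A → ∣ c₀ ∣ ≡ b → Empty (c₀ ∩ proj₁ χ zero) → TupleColouring b (A ∷ As)
colouring-cons {c₀ = c₀} (c , ⊆L , ∣c∣≡b , proper) c₀⊆A ∣c₀∣≡b disjoint =
  c₀ ◂ c , (λ { zero → c₀⊆A ; (suc i) → ⊆L i }) , (λ { zero → ∣c₀∣≡b ; (suc i) → ∣c∣≡b i })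
         , (λ { zero → disjoint ; (suc i) → proper i })

bound-cons : ∀ b n t u x s →
  b + t ≤ u + x → b * n ≤ s + t → b * suc n ≤ (x + s) + u
bound-cons b n t u x s step ih = +-cancelʳ-≤ t _ _ (begin
  b * suc n + t     ≡⟨ cong (_+ t) (*-suc b n) ⟩
  b + b * n + t     ≡⟨ xy∙z≈xz∙y b (b * n) t ⟩
  (b + t) + b * n   ≤⟨ +-mono-≤ step ih ⟩
  (u + x) + (s + t) ≡⟨ +-assoc (u + x) s t ⟨
  (u + x) + s + t   ≡⟨ cong (_+ t) (xy∙z≈yz∙x u x s) ⟩
  (x + s) + u + t   ∎)
  where open ≤-Reasoning

colouring⇒bound : ∀ (P : Subset k) (L : Vec (Subset k) (suc n)) (χ : TupleColouring b L) →
  b * suc n ≤ Xsum P L + ∣ proj₁ χ zero ∩ P ∣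
colouring⇒bound {b = b} P (A ∷ []) (c , ⊆L , ∣c∣≡b , _) = begin
  b * 1                          ≡⟨ *-identityʳ b ⟩
  b                              ≡⟨ ∣c∣≡b zero ⟨
  ∣ c zero ∣                     ≤⟨ ∣p∣≤∣p∩r∣+∣q─r∣ P (⊆L zero) ⟩
  ∣ c zero ∩ P ∣ + ∣ A ─ P ∣     ≡⟨ +-comm ∣ c zero ∩ P ∣ _ ⟩
  ∣ A ─ P ∣ + ∣ c zero ∩ P ∣     ≡⟨ cong (_+ ∣ c zero ∩ P ∣) (+-identityʳ ∣ A ─ P ∣) ⟨
  ∣ A ─ P ∣ + 0 + ∣ c zero ∩ P ∣ ∎
  where open ≤-Reasoning
colouring⇒bound {n = suc n} {b = b} P (A ∷ A′ ∷ As) χ@(c , ⊆L , ∣c∣≡b , proper) =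
  bound-cons b (suc n) t ∣ c zero ∩ P ∣ ∣ A ─ P ∣ (Xsum (A ─ P) (A′ ∷ As)) step
    (colouring⇒bound (A ─ P) (A′ ∷ As) (colouring-tail χ))
  where
  t : ℕ
  t = ∣ c (suc zero) ∩ (A ─ P) ∣
  step : b + t ≤ ∣ c zero ∩ P ∣ + ∣ A ─ P ∣
  step = subst (λ a → a + t ≤ ∣ c zero ∩ P ∣ + ∣ A ─ P ∣) (∣c∣≡b zero)
    (∣p∣+∣q∩[r─s]∣≤∣p∩s∣+∣r─s∣ P (⊆L zero) (proper zero))

Roomy : ℕ → Vec (Subset k) (suc n) → Set
Roomy b (A ∷ [])      = b ≤ ∣ A ∣
Roomy b (A ∷ A′ ∷ As) = b + b ≤ ∣ A ∣ × Roomy b (A′ ∷ As)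

-- P and K stand for X_{i-1} and K_{i-1} at the first vertex v_i of the list; that vertex may
-- have fewer than 2b colours only when K = 0, which is the case i = 1.
Admissible : ℕ → Subset k → ℕ → Vec (Subset k) (suc n) → Set
Admissible b P K (A ∷ [])      = b ≤ ∣ A ∣
Admissible b P K (A ∷ A′ ∷ As) = b ≤ ∣ A ─ P ∣ + K × (K ≡ 0 ⊎ b + b ≤ ∣ A ∣) × Roomy b (A′ ∷ As)

Roomy⇒Admissible : Roomy b (A ∷ As) → b + K′ ≡ ∣ Q ∣ + K → Admissible b Q K′ (A ∷ As)
Roomy⇒Admissible {As = []} b≤∣A∣ _ = b≤∣A∣
Roomy⇒Admissible {b = b} {A = A} {As = _ ∷ _} {K′ = K′} {Q = Q} {K = K} (2b≤∣A∣ , roomy) budget =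
  +-cancelˡ-≤ b _ _ (begin
    b + b                    ≤⟨ 2b≤∣A∣ ⟩
    ∣ A ∣                    ≤⟨ ∣p∣≤∣p─q∣+∣q∣ A Q ⟩
    ∣ A ─ Q ∣ + ∣ Q ∣        ≤⟨ +-monoʳ-≤ ∣ A ─ Q ∣ (m≤m+n ∣ Q ∣ K) ⟩
    ∣ A ─ Q ∣ + (∣ Q ∣ + K)  ≡⟨ cong (∣ A ─ Q ∣ +_) budget ⟨
    ∣ A ─ Q ∣ + (b + K′)     ≡⟨ x∙yz≈y∙xz ∣ A ─ Q ∣ b K′ ⟩
    b + (∣ A ─ Q ∣ + K′)     ∎)
  , inj₂ 2b≤∣A∣ , roomy
  where open ≤-Reasoning

bound-tail : ∀ b n x s → b + K′ ≡ x + K → b * suc n ≤ (x + s) + K → b * n ≤ s + K′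
bound-tail {K′} {K} b n x s budget bound = +-cancelˡ-≤ b _ _ (begin
  b + b * n     ≡⟨ *-suc b n ⟨
  b * suc n     ≤⟨ bound ⟩
  (x + s) + K   ≡⟨ xy∙z≈y∙xz x s K ⟩
  s + (x + K)   ≡⟨ cong (s +_) budget ⟨
  s + (b + K′)  ≡⟨ x∙yz≈y∙xz s b K′ ⟩
  b + (s + K′)  ∎)
  where open ≤-Reasoning

choose-head : ∀ (A P C : Subset k) → b + K′ ≡ ∣ A ─ P ∣ + K → (K ≡ 0 ⊎ b + b ≤ ∣ A ∣) →
  ∣ C ∣ ≡ b → ∣ C ∩ (A ─ P) ∣ ≤ K′ → ∃[ c₀ ] c₀ ⊆ A ─ C × ∣ c₀ ∣ ≡ b × ∣ c₀ ∩ P ∣ ≤ K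
choose-head {b = b} {K′ = K′} {K = K} A P C budget room ∣C∣≡b meet =
  choose-⊆ (A ─ C) P b K fresh (enough room)
  where
  open ≤-Reasoning
  fresh : b ≤ ∣ A ─ C ─ P ∣ + K
  fresh = +-cancelʳ-≤ K′ _ _ (begin
    b + K′                                ≡⟨ budget ⟩
    ∣ A ─ P ∣ + K                         ≡⟨ cong (_+ K) (∣p∣≡∣p∩q∣+∣p─q∣ (A ─ P) C) ⟩
    ∣ (A ─ P) ∩ C ∣ + ∣ A ─ P ─ C ∣ + K   ≡⟨ cong₂ (λ u v → u + v + K)
                                               (cong ∣_∣ (∩-comm (A ─ P) C)) (cong ∣_∣ (p─q─r≡p─r─q A P C)) ⟩
    ∣ C ∩ (A ─ P) ∣ + ∣ A ─ C ─ P ∣ + K   ≤⟨ +-monoˡ-≤ K (+-monoˡ-≤ ∣ A ─ C ─ P ∣ meet) ⟩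
    K′ + ∣ A ─ C ─ P ∣ + K                ≡⟨ xy∙z≈yz∙x K′ ∣ A ─ C ─ P ∣ K ⟩
    ∣ A ─ C ─ P ∣ + K + K′                ∎)
  enough : K ≡ 0 ⊎ b + b ≤ ∣ A ∣ → b ≤ ∣ A ─ C ∣
  enough (inj₁ refl) =
    ≤-trans fresh (≤-trans (≤-reflexive (+-identityʳ _)) (∣p─q∣≤∣p∣ (A ─ C) P))
  enough (inj₂ 2b≤∣A∣) = +-cancelʳ-≤ b _ _ (begin
    b + b             ≤⟨ 2b≤∣A∣ ⟩
    ∣ A ∣             ≤⟨ ∣p∣≤∣p─q∣+∣q∣ A C ⟩
    ∣ A ─ C ∣ + ∣ C ∣ ≡⟨ cong (∣ A ─ C ∣ +_) ∣C∣≡b ⟩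
    ∣ A ─ C ∣ + b     ∎)

bound⇒colouring : ∀ (P : Subset k) K (L : Vec (Subset k) (suc n)) →
  Admissible b P K L → b * suc n ≤ Xsum P L + K →
  Σ (TupleColouring b L) λ χ → ∣ proj₁ χ zero ∩ P ∣ ≤ K
bound⇒colouring {b = b} P K (A ∷ []) b≤∣A∣ bound =
  let c₀ , c₀⊆A , ∣c₀∣≡b , meet = choose-⊆ A P b K b≤∣A─P∣+K b≤∣A∣
  in ((λ _ → c₀) , (λ { zero → c₀⊆A }) , (λ _ → ∣c₀∣≡b) , λ ()) , meet
  where
  b≤∣A─P∣+K : b ≤ ∣ A ─ P ∣ + K
  b≤∣A─P∣+K = subst₂ _≤_ (*-identityʳ b) (cong (_+ K) (+-identityʳ ∣ A ─ P ∣)) bound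
bound⇒colouring {n = suc n} {b = b} P K (A ∷ A′ ∷ As) (b≤∣X∣+K , room , roomy) bound =
  let χ@(c , _ , ∣c∣≡b , _) , meet′ =
        bound⇒colouring (A ─ P) K₁ (A′ ∷ As) (Roomy⇒Admissible roomy budget)
          (bound-tail b (suc n) ∣ A ─ P ∣ (Xsum (A ─ P) (A′ ∷ As)) budget bound)
      c₀ , c₀⊆A─C , ∣c₀∣≡b , meet = choose-head A P (c zero) budget room (∣c∣≡b zero) meet′
  in colouring-cons χ (⊆-trans c₀⊆A─C (p─q⊆p A _)) ∣c₀∣≡b (p⊆q─r⇒Empty[p∩r] A _ c₀⊆A─C) , meet
  where
  K₁ : ℕ
  K₁ = ∣ A ─ P ∣ + K ∸ b
  budget : b + K₁ ≡ ∣ A ─ P ∣ + K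
  budget = m+[n∸m]≡n b≤∣X∣+K

roomy-path : ∀ (L : Vec (Subset k) (suc n)) →
  (∀ i → toℕ i ≢ n → b + b ≤ ∣ lookup L i ∣) → b ≤ ∣ lookup L (fromℕ n) ∣ → Roomy b L
roomy-path (A ∷ [])      _        b≤∣last∣ = b≤∣last∣
roomy-path (A ∷ A′ ∷ As) interior b≤∣last∣ =
  interior zero (λ ()) , roomy-path (A′ ∷ As) (λ i i≢n → interior (suc i) (i≢n ∘ suc-injective)) b≤∣last∣

admissible-path : ∀ (L : Vec (Subset k) (suc n)) →
  b ≤ ∣ lookup L zero ∣ → b ≤ ∣ lookup L (fromℕ n) ∣ →
  (∀ i → toℕ i ≢ 0 → toℕ i ≢ n → b + b ≤ ∣ lookup L i ∣) → Admissible b ⊥ 0 L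
admissible-path (A ∷ [])      b≤∣A∣ _        _        = b≤∣A∣
admissible-path (A ∷ A′ ∷ As) b≤∣A∣ b≤∣last∣ interior =
  subst (_ ≤_) (sym (trans (+-identityʳ _) (cong ∣_∣ (p─⊥≡p A)))) b≤∣A∣ , inj₁ refl ,
  roomy-path (A′ ∷ As) (λ i i≢n → interior (suc i) (λ ()) (i≢n ∘ suc-injective)) b≤∣last∣

lemma2p1 : (m k n : ℕ) → 1 ≤ m → (L : Vec (Subset k) (suc n)) →
    ∣ lookup L zero ∣ ≡ ∣ lookup L (fromℕ n) ∣ →
    2 * m ≤ ∣ lookup L zero ∣ →
    (∀ (i : Fin (suc n)) → toℕ i ≢ 0 → toℕ i ≢ n → ∣ lookup L i ∣ ≡ 4 * m) →
    TupleColouring (2 * m) L ⇔ (2 * m * suc n ≤ S L)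
lemma2p1 m k n _ L ∣first∣≡∣last∣ 2m≤∣first∣ ∣interior∣≡4m = mk⇔
  (λ χ → subst (2 * m * suc n ≤_) (S+∣c₀∩⊥∣≡S χ) (colouring⇒bound ⊥ L χ))
  (λ bound → proj₁ (bound⇒colouring ⊥ 0 L admissible
                      (subst (2 * m * suc n ≤_) (sym (+-identityʳ (S L))) bound)))
  where
  S+∣c₀∩⊥∣≡S : (χ : TupleColouring (2 * m) L) → S L + ∣ proj₁ χ zero ∩ ⊥ ∣ ≡ S L
  S+∣c₀∩⊥∣≡S (c , _) = begin
    S L + ∣ c zero ∩ ⊥ ∣ ≡⟨ cong (λ p → S L + ∣ p ∣) (∩-zeroʳ (c zero)) ⟩
    S L + ∣ ⊥ {n = k} ∣  ≡⟨ cong (S L +_) (∣⊥∣≡0 k) ⟩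
    S L + 0              ≡⟨ +-identityʳ (S L) ⟩
    S L                  ∎
    where open ≡-Reasoning
  admissible : Admissible (2 * m) ⊥ 0 L
  admissible = admissible-path L 2m≤∣first∣ (subst (2 * m ≤_) ∣first∣≡∣last∣ 2m≤∣first∣)
    (λ i i≢0 i≢n → ≤-reflexive (sym (trans (∣interior∣≡4m i i≢0 i≢n) (*-distribʳ-+ m 2 2))))
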